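{- Let $T$ be a finite set with $T=S_j\uplus P_j$ for $j=1,\dots,n$, and let $\mathcal M_T$ be a matroid on $T$ which is $\{S_j,P_j\}$-complete for each $j=1,\dots,n$. Let $\{T_1,\dots,T_k\}$ be a partition of $T$ (blocks may be empty) such that for each pair $m\neq l$ there is some $j$ with $T_m\subseteq S_j$ and $T_l\subseteq P_j$. \begin{enumerate} \item If $\mathcal M_Q$, $Q\subseteq T$, is a minor of $\mathcal M_T$, then $\mathcal M_Q$ is $\{S_j\cap Q,P_j\cap Q\}$-complete for $j=1,\dots,n$. \item Let $\{Q_1,\dots,Q_k\}$ be a partition of a set $Q\subseteq T$ with $Q_j\subseteq T_j$ for $j=1,\dots,k$. Then for $i\neq j$ in $\{1,\dots,k\}$, every minor $\mathcal M_{Q_iQ_j}$ of $\mathcal M_T$ on $Q_i\uplus Q_j$ is $\{Q_i,Q_j\}$-complete. \end{enumerate}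
   Context: A minor of a matroid $\mathcal M$ on $X$ is a matroid $(\mathcal M\circ A)\times B$ with $B\subseteq A\subseteq X$, where $\circ A$ is restriction to $A$ (delete $X-A$) and $\times B$ is contraction to $B$ (contract $A-B$). A matroid $\mathcal M_{AB}$ on $A\uplus B$ is $\{A,B\}$-complete if whenever $b_A,b'_A\subseteq A$, $b_B,b'_B\subseteq B$ and $b_A\uplus b_B$, $b_A\uplus b'_B$, $b'_A\uplus b_B$ are bases of $\mathcal M_{AB}$, also $b'_A\uplus b'_B$ is a base. (Every matroid on $X$ is trivially $\{X,\emptyset\}$-complete.) -}

module Defs where

open import Data.Nat using (ℕ)
open import Data.Fin using (Fin)
open import Data.Fin.Subset
open import Data.Product using (Σ; ∃; _×_; _,_)
open import Relation.Binary.PropositionalEquality using (_≡_)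

record Matroid (N : ℕ) : Set₁ where
  field
    IsBase   : Subset N → Set
    base∃    : ∃ λ B → IsBase B
    exchange : ∀ {B₁ B₂ x} → IsBase B₁ → IsBase B₂ → x ∈ B₁ → x ∉ B₂ →
               ∃ λ y → y ∈ B₂ × y ∉ B₁ × IsBase ((B₁ - x) ∪ ⁅ y ⁆)
open Matroid public

module _ {N : ℕ} (M : Matroid N) where

  Indep : Subset N → Set
  Indep I = ∃ λ B → IsBase M B × I ⊆ B

  RestrBase : Subset N → Subset N → Set
  RestrBase A I = I ⊆ A × Indep I ×
    (∀ J → I ⊆ J → J ⊆ A → Indep J → J ≡ I)

  -- b is a base of the minor (M ∘ A) × B  (restrict to A, then contract A ─ B):
  -- b ⊆ B and b ∪ I is a base of M ∘ A for a base I of (M ∘ A) ∘ (A ─ B).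
  MinorBase : Subset N → Subset N → Subset N → Set
  MinorBase A B b = b ⊆ B × (∃ λ I → RestrBase (A ─ B) I × RestrBase A (b ∪ I))

Complete : {N : ℕ} → (Subset N → Set) → Subset N → Subset N → Set
Complete Base X Y = ∀ bX bX' bY bY' → bX ⊆ X → bX' ⊆ X → bY ⊆ Y → bY' ⊆ Y →
  Base (bX ∪ bY) → Base (bX ∪ bY') → Base (bX' ∪ bY) → Base (bX' ∪ bY')

-- A base of the minor (M ∘ A) × B is a set b ⊆ B with b ∪ I a base of M ∘ A, where I is any fixed
-- base of M ∘ (A ─ B); the choice of I does not matter. Fix a base B₁ of M whose trace on A is a
-- base of M ∘ A and put K = B₁ ─ A. Since all bases have the same size, J ↦ J ∪ K is a bijection
-- from the bases of M ∘ A onto the bases of M of the form J ∪ K with J ⊆ A. Hence, with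
-- R = I ∪ K, a set bS ∪ bP is a base of the minor iff (bS ∪ (R ∩ S)) ∪ (bP ∪ (R ∩ P)) is a base
-- of M, and {S,P}-completeness of M transfers to the minor. Part 2 is Part 1 for an index j
-- separating the two blocks.
module Submission where

open import Defs
open import Data.Nat using (ℕ; suc; _+_; _≤_; _<_; s≤s)
open import Data.Nat.Properties
  using (+-suc; +-comm; m≤m+n; ≤-trans; +-monoˡ-≤; +-monoʳ-≤; +-cancelʳ-≤; <-irrefl; +-identityʳ; module ≤-Reasoning)
open import Data.Nat.Induction using (<-wellFounded)
open import Induction.WellFounded using (Acc; acc)
open import Data.Bool using (true; false)
open import Data.Fin using (Fin; zero)
open import Data.Fin.Subset
open import Data.Fin.Subset.Properties
open import Data.Vec.Base using ([]; _∷_; here; there)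
open import Data.Product using (∃; _×_; _,_; proj₁; proj₂)
open import Data.Sum using (inj₁; inj₂; [_,_]′)
open import Data.Empty using (⊥-elim)
open import Function using (_∘_)
open import Relation.Nullary using (yes; no)
open import Relation.Binary.PropositionalEquality
import Algebra.Bundles as Bundles
import Algebra.Properties.CommutativeSemigroup as CommutativeSemigroupProperties

x∈p─q⁻ : ∀ {n} (p q : Subset n) {x} → x ∈ p ─ q → x ∈ p × x ∉ q
x∈p─q⁻ (true ∷ p) (false ∷ q) here = here , λ ()
x∈p─q⁻ (true ∷ p) (true ∷ q) {zero} ()
x∈p─q⁻ (false ∷ p) (true ∷ q) {zero} ()
x∈p─q⁻ (false ∷ p) (false ∷ q) {zero} ()
x∈p─q⁻ (s ∷ p) (t ∷ q) (there x∈) with x∈p─q⁻ p q x∈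
... | x∈p , x∉q = there x∈p , x∉q ∘ drop-there

∪-least : ∀ {n} {p q r : Subset n} → p ⊆ r → q ⊆ r → p ∪ q ⊆ r
∪-least {p = p} {q} p⊆r q⊆r x∈ = [ p⊆r , q⊆r ]′ (x∈p∪q⁻ p q x∈)

x∈q⇒x∉p─q : ∀ {n} (p q : Subset n) {x} → x ∈ q → x ∉ p ─ q
x∈q⇒x∉p─q p q x∈q x∈p─q = proj₂ (x∈p─q⁻ p q x∈p─q) x∈q

Empty[p─q]⇒p⊆q : ∀ {n} {p q : Subset n} → Empty (p ─ q) → p ⊆ q
Empty[p─q]⇒p⊆q {p = p} {q} empty {x} x∈p with x ∈? q
... | yes x∈q = x∈q
... | no x∉q = ⊥-elim (empty (x , x∈p∧x∉q⇒x∈p─q x∈p x∉q))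

∪-interchange-split : ∀ {n} {s p : Subset n} → s ∪ p ≡ ⊤ → ∀ u v r →
  (u ∪ v) ∪ r ≡ (u ∪ (r ∩ s)) ∪ (v ∪ (r ∩ p))
∪-interchange-split {n} {s} {p} s∪p≡⊤ u v r = begin
  (u ∪ v) ∪ r                    ≡⟨ cong ((u ∪ v) ∪_) r≡r∩[s∪p] ⟩
  (u ∪ v) ∪ (r ∩ (s ∪ p))        ≡⟨ cong ((u ∪ v) ∪_) (∩-distribˡ-∪ r s p) ⟩
  (u ∪ v) ∪ ((r ∩ s) ∪ (r ∩ p))  ≡⟨ interchange u v (r ∩ s) (r ∩ p) ⟩
  (u ∪ (r ∩ s)) ∪ (v ∪ (r ∩ p))  ∎
  where
  open ≡-Reasoning
  open CommutativeSemigroupProperties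
    (Bundles.CommutativeMonoid.commutativeSemigroup (∪-commutativeMonoid n)) using (interchange)
  r≡r∩[s∪p] : r ≡ r ∩ (s ∪ p)
  r≡r∩[s∪p] = sym (trans (cong (r ∩_) s∪p≡⊤) (∩-identityʳ r))

p∩[a∪b]≡a : ∀ {n} {p q a b : Subset n} → p ∩ q ≡ ⊥ → a ⊆ p → b ⊆ q → p ∩ (a ∪ b) ≡ a
p∩[a∪b]≡a {p = p} {q} {a} {b} p∩q≡⊥ a⊆p b⊆q = ⊆-antisym ⊆a (λ x∈a → x∈p∩q⁺ (a⊆p x∈a , p⊆p∪q b x∈a))
  where
  ⊆a : p ∩ (a ∪ b) ⊆ a
  ⊆a x∈ with x∈p∩q⁻ p (a ∪ b) x∈
  ... | x∈p , x∈a∪b with x∈p∪q⁻ a b x∈a∪b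
  ...   | inj₁ x∈a = x∈a
  ...   | inj₂ x∈b = ⊥-elim (∉⊥ (subst (_ ∈_) p∩q≡⊥ (x∈p∩q⁺ (x∈p , b⊆q x∈b))))

∣p∪q∣+∣p∩q∣≡∣p∣+∣q∣ : ∀ {n} (p q : Subset n) → ∣ p ∪ q ∣ + ∣ p ∩ q ∣ ≡ ∣ p ∣ + ∣ q ∣
∣p∪q∣+∣p∩q∣≡∣p∣+∣q∣ [] [] = refl
∣p∪q∣+∣p∩q∣≡∣p∣+∣q∣ (true ∷ p) (true ∷ q) =
  cong suc (trans (+-suc _ _) (trans (cong suc (∣p∪q∣+∣p∩q∣≡∣p∣+∣q∣ p q)) (sym (+-suc _ _))))
∣p∪q∣+∣p∩q∣≡∣p∣+∣q∣ (true ∷ p) (false ∷ q) = cong suc (∣p∪q∣+∣p∩q∣≡∣p∣+∣q∣ p q)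
∣p∪q∣+∣p∩q∣≡∣p∣+∣q∣ (false ∷ p) (true ∷ q) = trans (cong suc (∣p∪q∣+∣p∩q∣≡∣p∣+∣q∣ p q)) (sym (+-suc _ _))
∣p∪q∣+∣p∩q∣≡∣p∣+∣q∣ (false ∷ p) (false ∷ q) = ∣p∪q∣+∣p∩q∣≡∣p∣+∣q∣ p q

∣p∪q∣≤∣p∣+∣q∣ : ∀ {n} (p q : Subset n) → ∣ p ∪ q ∣ ≤ ∣ p ∣ + ∣ q ∣
∣p∪q∣≤∣p∣+∣q∣ p q = subst (∣ p ∪ q ∣ ≤_) (∣p∪q∣+∣p∩q∣≡∣p∣+∣q∣ p q) (m≤m+n _ _)

disjoint⇒∣p∪q∣≡∣p∣+∣q∣ : ∀ {n} (p q : Subset n) → (∀ {x} → x ∈ p → x ∉ q) → ∣ p ∪ q ∣ ≡ ∣ p ∣ + ∣ q ∣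
disjoint⇒∣p∪q∣≡∣p∣+∣q∣ {n} p q disjoint = begin
  ∣ p ∪ q ∣              ≡⟨ sym (+-identityʳ _) ⟩
  ∣ p ∪ q ∣ + 0          ≡⟨ cong (∣ p ∪ q ∣ +_) (sym ∣p∩q∣≡0) ⟩
  ∣ p ∪ q ∣ + ∣ p ∩ q ∣  ≡⟨ ∣p∪q∣+∣p∩q∣≡∣p∣+∣q∣ p q ⟩
  ∣ p ∣ + ∣ q ∣          ∎
  where
  open ≡-Reasoning
  ∣p∩q∣≡0 : ∣ p ∩ q ∣ ≡ 0
  ∣p∩q∣≡0 = trans (cong ∣_∣ (Empty-unique λ (_ , x∈) → let x∈p , x∈q = x∈p∩q⁻ p q x∈ in disjoint x∈p x∈q))
                  (∣⊥∣≡0 n)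

∣p∩q∣+∣p─q∣≡∣p∣ : ∀ {n} (p q : Subset n) → ∣ p ∩ q ∣ + ∣ p ─ q ∣ ≡ ∣ p ∣
∣p∩q∣+∣p─q∣≡∣p∣ [] [] = refl
∣p∩q∣+∣p─q∣≡∣p∣ (true ∷ p) (true ∷ q) = cong suc (∣p∩q∣+∣p─q∣≡∣p∣ p q)
∣p∩q∣+∣p─q∣≡∣p∣ (true ∷ p) (false ∷ q) = trans (+-suc _ _) (cong suc (∣p∩q∣+∣p─q∣≡∣p∣ p q))
∣p∩q∣+∣p─q∣≡∣p∣ (false ∷ p) (true ∷ q) = ∣p∩q∣+∣p─q∣≡∣p∣ p q
∣p∩q∣+∣p─q∣≡∣p∣ (false ∷ p) (false ∷ q) = ∣p∩q∣+∣p─q∣≡∣p∣ p q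

p⊆q⇒∣q∣≤∣p∣⇒p≡q : ∀ {n} {p q : Subset n} → p ⊆ q → ∣ q ∣ ≤ ∣ p ∣ → p ≡ q
p⊆q⇒∣q∣≤∣p∣⇒p≡q {p = []} {q = []} _ _ = refl
p⊆q⇒∣q∣≤∣p∣⇒p≡q {p = true ∷ p} {q = true ∷ q} p⊆q (s≤s ∣q∣≤∣p∣) =
  cong (true ∷_) (p⊆q⇒∣q∣≤∣p∣⇒p≡q (drop-∷-⊆ p⊆q) ∣q∣≤∣p∣)
p⊆q⇒∣q∣≤∣p∣⇒p≡q {p = true ∷ p} {q = false ∷ q} p⊆q _ with p⊆q here
... | ()
p⊆q⇒∣q∣≤∣p∣⇒p≡q {p = false ∷ p} {q = true ∷ q} p⊆q ∣q∣≤∣p∣ =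
  ⊥-elim (<-irrefl refl (≤-trans (s≤s (p⊆q⇒∣p∣≤∣q∣ (drop-∷-⊆ p⊆q))) ∣q∣≤∣p∣))
p⊆q⇒∣q∣≤∣p∣⇒p≡q {p = false ∷ p} {q = false ∷ q} p⊆q ∣q∣≤∣p∣ =
  cong (false ∷_) (p⊆q⇒∣q∣≤∣p∣⇒p≡q (drop-∷-⊆ p⊆q) ∣q∣≤∣p∣)

x∈p⇒suc∣p-x∣≡∣p∣ : ∀ {n} (p : Subset n) {x} → x ∈ p → suc ∣ p - x ∣ ≡ ∣ p ∣
x∈p⇒suc∣p-x∣≡∣p∣ (true ∷ p) here = cong (suc ∘ ∣_∣) (p─⊥≡p p)
x∈p⇒suc∣p-x∣≡∣p∣ (true ∷ p) (there x∈p) = cong suc (x∈p⇒suc∣p-x∣≡∣p∣ p x∈p)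
x∈p⇒suc∣p-x∣≡∣p∣ (false ∷ p) (there x∈p) = x∈p⇒suc∣p-x∣≡∣p∣ p x∈p

x∉p⇒∣p∪⁅x⁆∣≡suc∣p∣ : ∀ {n} (p : Subset n) {x} → x ∉ p → ∣ p ∪ ⁅ x ⁆ ∣ ≡ suc ∣ p ∣
x∉p⇒∣p∪⁅x⁆∣≡suc∣p∣ p {x} x∉p = begin
  ∣ p ∪ ⁅ x ⁆ ∣      ≡⟨ disjoint⇒∣p∪q∣≡∣p∣+∣q∣ p ⁅ x ⁆ (λ y∈p y∈⁅x⁆ → x∉p (subst (_∈ p) (x∈⁅y⁆⇒x≡y x y∈⁅x⁆) y∈p)) ⟩
  ∣ p ∣ + ∣ ⁅ x ⁆ ∣  ≡⟨ cong (∣ p ∣ +_) (∣⁅x⁆∣≡1 x) ⟩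
  ∣ p ∣ + 1          ≡⟨ +-comm ∣ p ∣ 1 ⟩
  suc ∣ p ∣          ∎
  where open ≡-Reasoning

∣p-x∪⁅y⁆∣≡∣p∣ : ∀ {n} {p : Subset n} {x y} → x ∈ p → y ∉ p → ∣ (p - x) ∪ ⁅ y ⁆ ∣ ≡ ∣ p ∣
∣p-x∪⁅y⁆∣≡∣p∣ {p = p} {x} x∈p y∉p =
  trans (x∉p⇒∣p∪⁅x⁆∣≡suc∣p∣ (p - x) (y∉p ∘ proj₁ ∘ x∈p─q⁻ p ⁅ x ⁆)) (x∈p⇒suc∣p-x∣≡∣p∣ p x∈p)

q⊆p⇒x∉q⇒q⊆p-x∪⁅y⁆ : ∀ {n} {p q : Subset n} {x y} → q ⊆ p → x ∉ q → q ⊆ (p - x) ∪ ⁅ y ⁆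
q⊆p⇒x∉q⇒q⊆p-x∪⁅y⁆ {q = q} {y = y} q⊆p x∉q z∈q =
  p⊆p∪q ⁅ y ⁆ (x∈p∧x∉q⇒x∈p─q (q⊆p z∈q) (λ z∈⁅x⁆ → x∉q (subst (_∈ q) (x∈⁅y⁆⇒x≡y _ z∈⁅x⁆) z∈q)))

p-x∪⁅y⁆─w⊂p─w : ∀ {n} (p w : Subset n) {x y} → x ∈ p → x ∉ w → y ∈ w → ((p - x) ∪ ⁅ y ⁆) ─ w ⊂ p ─ w
p-x∪⁅y⁆─w⊂p─w p w {x} {y} x∈p x∉w y∈w = ⊆p─w , x , x∈p∧x∉q⇒x∈p─q x∈p x∉w , x∉
  where
  ⊆p─w : ((p - x) ∪ ⁅ y ⁆) ─ w ⊆ p ─ w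
  ⊆p─w z∈ with x∈p─q⁻ _ w z∈
  ... | z∈∪ , z∉w with x∈p∪q⁻ (p - x) ⁅ y ⁆ z∈∪
  ...   | inj₁ z∈p-x = x∈p∧x∉q⇒x∈p─q (proj₁ (x∈p─q⁻ p ⁅ x ⁆ z∈p-x)) z∉w
  ...   | inj₂ z∈⁅y⁆ = ⊥-elim (z∉w (subst (_∈ w) (sym (x∈⁅y⁆⇒x≡y y z∈⁅y⁆)) y∈w))
  x∉ : x ∉ ((p - x) ∪ ⁅ y ⁆) ─ w
  x∉ x∈ with x∈p─q⁻ _ w x∈
  ... | x∈∪ , _ with x∈p∪q⁻ (p - x) ⁅ y ⁆ x∈∪
  ...   | inj₁ x∈p-x = proj₂ (x∈p─q⁻ p ⁅ x ⁆ x∈p-x) (x∈⁅x⁆ x)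
  ...   | inj₂ x∈⁅y⁆ = x∉w (subst (_∈ w) (sym (x∈⁅y⁆⇒x≡y y x∈⁅y⁆)) y∈w)

module _ {N : ℕ} (M : Matroid N) where

  isBase⇒indep : ∀ {B} → IsBase M B → Indep M B
  isBase⇒indep {B} b = B , b , λ x∈ → x∈

  indep-⊆ : ∀ {I J} → Indep M J → I ⊆ J → Indep M I
  indep-⊆ (B , b , J⊆B) I⊆J = B , b , J⊆B ∘ I⊆J

  -- Each exchange of an element of B₀ outside J ∪ B for one of B lowers ∣ B₀ ─ (J ∪ B) ∣.
  exchange-into : ∀ {J B₀ B} → J ⊆ B₀ → IsBase M B₀ → IsBase M B →
    ∃ λ B' → IsBase M B' × ∣ B' ∣ ≡ ∣ B₀ ∣ × J ⊆ B' × B' ⊆ J ∪ B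
  exchange-into {J} {B = B} J⊆B₀ b₀ b = go (<-wellFounded _) J⊆B₀ b₀
    where
    go : ∀ {B₀} → Acc _<_ ∣ B₀ ─ (J ∪ B) ∣ → J ⊆ B₀ → IsBase M B₀ →
      ∃ λ B' → IsBase M B' × ∣ B' ∣ ≡ ∣ B₀ ∣ × J ⊆ B' × B' ⊆ J ∪ B
    go {B₀} (acc rs) J⊆B₀ b₀ with nonempty? (B₀ ─ (J ∪ B))
    ... | no empty = B₀ , b₀ , refl , J⊆B₀ , Empty[p─q]⇒p⊆q empty
    ... | yes (x , x∈) with x∈p─q⁻ B₀ (J ∪ B) x∈
    ...   | x∈B₀ , x∉J∪B with exchange M b₀ b x∈B₀ (x∉J∪B ∘ q⊆p∪q J B)
    ...     | y , y∈B , y∉B₀ , b₁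
            with go (rs (p⊂q⇒∣p∣<∣q∣ (p-x∪⁅y⁆─w⊂p─w B₀ (J ∪ B) x∈B₀ x∉J∪B (q⊆p∪q J B y∈B))))
                    (q⊆p⇒x∉q⇒q⊆p-x∪⁅y⁆ J⊆B₀ (x∉J∪B ∘ p⊆p∪q B)) b₁
    ...       | B' , b' , ∣B'∣≡∣B₁∣ , J⊆B' , B'⊆J∪B =
      B' , b' , trans ∣B'∣≡∣B₁∣ (∣p-x∪⁅y⁆∣≡∣p∣ x∈B₀ y∉B₀) , J⊆B' , B'⊆J∪B

  ∣base∣≤∣base∣ : ∀ {B₁ B₂} → IsBase M B₁ → IsBase M B₂ → ∣ B₁ ∣ ≤ ∣ B₂ ∣
  ∣base∣≤∣base∣ {B₁} {B₂} b₁ b₂ with exchange-into (⊆-min B₁) b₁ b₂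
  ... | B' , _ , ∣B'∣≡∣B₁∣ , _ , B'⊆⊥∪B₂ =
    subst (_≤ ∣ B₂ ∣) ∣B'∣≡∣B₁∣ (p⊆q⇒∣p∣≤∣q∣ (subst (B' ⊆_) (∪-identityˡ B₂) B'⊆⊥∪B₂))

  restrBase-trace : ∀ {A J B} → RestrBase M A J → IsBase M B → J ⊆ B → B ∩ A ≡ J
  restrBase-trace {A} {B = B} (J⊆A , _ , maximal) b J⊆B =
    maximal (B ∩ A) (λ x∈J → x∈p∩q⁺ (J⊆B x∈J , J⊆A x∈J)) (p∩q⊆q B A) (indep-⊆ (isBase⇒indep b) (p∩q⊆p B A))

  restrBase⇒trace-of-base : ∀ {A J} → RestrBase M A J → ∃ λ B → IsBase M B × B ∩ A ≡ J
  restrBase⇒trace-of-base r@(_ , (B , b , J⊆B) , _) = B , b , restrBase-trace r b J⊆B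

  restrBase∪outside-contains-base : ∀ {A J B₁} → RestrBase M A J → IsBase M B₁ →
    ∃ λ B' → IsBase M B' × B' ⊆ J ∪ (B₁ ─ A)
  restrBase∪outside-contains-base {A} {J} {B₁} r@(_ , (B₀ , b₀ , J⊆B₀) , _) b₁
    with exchange-into J⊆B₀ b₀ b₁
  ... | B' , b' , _ , J⊆B' , B'⊆J∪B₁ = B' , b' , B'⊆
    where
    B'∩A≡J : B' ∩ A ≡ J
    B'∩A≡J = restrBase-trace r b' J⊆B'
    B'⊆ : B' ⊆ J ∪ (B₁ ─ A)
    B'⊆ {z} z∈B' with z ∈? A | x∈p∪q⁻ J B₁ (B'⊆J∪B₁ z∈B')
    ... | yes z∈A | _        = p⊆p∪q (B₁ ─ A) (subst (z ∈_) B'∩A≡J (x∈p∩q⁺ (z∈B' , z∈A)))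
    ... | no _    | inj₁ z∈J  = p⊆p∪q (B₁ ─ A) z∈J
    ... | no z∉A  | inj₂ z∈B₁ = q⊆p∪q J (B₁ ─ A) (x∈p∧x∉q⇒x∈p─q z∈B₁ z∉A)

  ∣indep∣≤∣restrBase∣ : ∀ {A J₀ J} → RestrBase M A J₀ → Indep M J → J ⊆ A → ∣ J ∣ ≤ ∣ J₀ ∣
  ∣indep∣≤∣restrBase∣ {A} {J₀} {J} r (B₁ , b₁ , J⊆B₁) J⊆A with restrBase∪outside-contains-base r b₁
  ... | B' , b' , B'⊆J₀∪K = +-cancelʳ-≤ ∣ K ∣ _ _ (begin
    ∣ J ∣ + ∣ K ∣       ≤⟨ +-monoˡ-≤ ∣ K ∣ (p⊆q⇒∣p∣≤∣q∣ (λ x∈J → x∈p∩q⁺ (J⊆B₁ x∈J , J⊆A x∈J))) ⟩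
    ∣ B₁ ∩ A ∣ + ∣ K ∣  ≡⟨ ∣p∩q∣+∣p─q∣≡∣p∣ B₁ A ⟩
    ∣ B₁ ∣              ≤⟨ ∣base∣≤∣base∣ b₁ b' ⟩
    ∣ B' ∣              ≤⟨ p⊆q⇒∣p∣≤∣q∣ B'⊆J₀∪K ⟩
    ∣ J₀ ∪ K ∣          ≤⟨ ∣p∪q∣≤∣p∣+∣q∣ J₀ K ⟩
    ∣ J₀ ∣ + ∣ K ∣      ∎)
    where
    open ≤-Reasoning
    K = B₁ ─ A

  ∣restrBase∣≤∣indep∣⇒restrBase : ∀ {A J₀ J} → RestrBase M A J₀ → Indep M J → J ⊆ A → ∣ J₀ ∣ ≤ ∣ J ∣ →
    RestrBase M A J
  ∣restrBase∣≤∣indep∣⇒restrBase r indep J⊆A ∣J₀∣≤∣J∣ = J⊆A , indep , λ K J⊆K K⊆A indepK →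
    sym (p⊆q⇒∣q∣≤∣p∣⇒p≡q J⊆K (≤-trans (∣indep∣≤∣restrBase∣ r indepK K⊆A) ∣J₀∣≤∣J∣))

  restrBase∪outside-isBase : ∀ {A J B₁} → IsBase M B₁ → RestrBase M A (B₁ ∩ A) → RestrBase M A J →
    IsBase M (J ∪ (B₁ ─ A))
  restrBase∪outside-isBase {A} {J} {B₁} b₁ r₁ r@(J⊆A , indep , _)
    with restrBase∪outside-contains-base r b₁
  ... | B' , b' , B'⊆J∪K = subst (IsBase M) (p⊆q⇒∣q∣≤∣p∣⇒p≡q B'⊆J∪K (begin
    ∣ J ∪ K ∣           ≤⟨ ∣p∪q∣≤∣p∣+∣q∣ J K ⟩
    ∣ J ∣ + ∣ K ∣       ≤⟨ +-monoˡ-≤ ∣ K ∣ (∣indep∣≤∣restrBase∣ r₁ indep J⊆A) ⟩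
    ∣ B₁ ∩ A ∣ + ∣ K ∣  ≡⟨ ∣p∩q∣+∣p─q∣≡∣p∣ B₁ A ⟩
    ∣ B₁ ∣              ≤⟨ ∣base∣≤∣base∣ b₁ b' ⟩
    ∣ B' ∣              ∎)) b'
    where
    open ≤-Reasoning
    K = B₁ ─ A

  base∪outside⇒restrBase : ∀ {A J B₁} → IsBase M B₁ → RestrBase M A (B₁ ∩ A) → J ⊆ A →
    IsBase M (J ∪ (B₁ ─ A)) → RestrBase M A J
  base∪outside⇒restrBase {A} {J} {B₁} b₁ r₁ J⊆A b =
    ∣restrBase∣≤∣indep∣⇒restrBase r₁ (indep-⊆ (isBase⇒indep b) (p⊆p∪q K)) J⊆A (+-cancelʳ-≤ ∣ K ∣ _ _ (begin
      ∣ B₁ ∩ A ∣ + ∣ K ∣  ≡⟨ ∣p∩q∣+∣p─q∣≡∣p∣ B₁ A ⟩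
      ∣ B₁ ∣              ≤⟨ ∣base∣≤∣base∣ b₁ b ⟩
      ∣ J ∪ K ∣           ≡⟨ disjoint⇒∣p∪q∣≡∣p∣+∣q∣ J K (x∈q⇒x∉p─q B₁ A ∘ J⊆A) ⟩
      ∣ J ∣ + ∣ K ∣       ∎))
    where
    open ≤-Reasoning
    K = B₁ ─ A

  restrBase-contraction-irrelevant : ∀ {A B I I' b} → B ⊆ A → RestrBase M (A ─ B) I → RestrBase M (A ─ B) I' →
    b ⊆ B → RestrBase M A (b ∪ I) → RestrBase M A (b ∪ I')
  restrBase-contraction-irrelevant {A} {B} {I} {I'} {b} B⊆A rI@(I⊆A─B , indepI , _) rI'@(I'⊆A─B , _ , _) b⊆B r
    with restrBase⇒trace-of-base r
  ... | B₀ , b₀ , B₀∩A≡b∪I = ∣restrBase∣≤∣indep∣⇒restrBase r indep b∪I'⊆A ∣b∪I∣≤∣b∪I'∣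
    where
    b∪I⊆B₀ : b ∪ I ⊆ B₀
    b∪I⊆B₀ x∈ = proj₁ (x∈p∩q⁻ B₀ A (subst (_ ∈_) (sym B₀∩A≡b∪I) x∈))
    b∉A─B : ∀ {x} → x ∈ b → x ∉ A ─ B
    b∉A─B = x∈q⇒x∉p─q A B ∘ b⊆B
    I'∪outside : IsBase M (I' ∪ (B₀ ─ (A ─ B)))
    I'∪outside = restrBase∪outside-isBase b₀
      (subst (RestrBase M (A ─ B)) (sym (restrBase-trace rI b₀ (b∪I⊆B₀ ∘ q⊆p∪q b I))) rI) rI'
    indep : Indep M (b ∪ I')
    indep = indep-⊆ (isBase⇒indep I'∪outside) (∪-least
      (λ x∈b → q⊆p∪q I' _ (x∈p∧x∉q⇒x∈p─q (b∪I⊆B₀ (p⊆p∪q I x∈b)) (b∉A─B x∈b)))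
      (p⊆p∪q _))
    b∪I'⊆A : b ∪ I' ⊆ A
    b∪I'⊆A = ∪-least (B⊆A ∘ b⊆B) (p─q⊆p A B ∘ I'⊆A─B)
    ∣b∪I∣≤∣b∪I'∣ : ∣ b ∪ I ∣ ≤ ∣ b ∪ I' ∣
    ∣b∪I∣≤∣b∪I'∣ = begin
      ∣ b ∪ I ∣       ≤⟨ ∣p∪q∣≤∣p∣+∣q∣ b I ⟩
      ∣ b ∣ + ∣ I ∣   ≤⟨ +-monoʳ-≤ ∣ b ∣ (∣indep∣≤∣restrBase∣ rI' indepI I⊆A─B) ⟩
      ∣ b ∣ + ∣ I' ∣  ≡⟨ disjoint⇒∣p∪q∣≡∣p∣+∣q∣ b I' (λ x∈b x∈I' → b∉A─B x∈b (I'⊆A─B x∈I')) ⟨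
      ∣ b ∪ I' ∣      ∎
      where open ≤-Reasoning

  minor-complete : ∀ {S P A B} → S ∪ P ≡ ⊤ → Complete (IsBase M) S P → B ⊆ A →
    Complete (MinorBase M A B) (S ∩ B) (P ∩ B)
  minor-complete {S} {P} {A} {B} S∪P≡⊤ complete B⊆A bX bX' bY bY' bX⊆ bX'⊆ bY⊆ bY'⊆
    (_ , I , rI , r₁) (_ , I₂ , rI₂ , r₂) (_ , I₃ , rI₃ , r₃) with restrBase⇒trace-of-base r₁
  ... | B₁ , b₁ , B₁∩A≡ = inB bX'⊆ bY'⊆ , I , rI ,
    fromBase (complete _ _ _ _ (sidePart bX⊆) (sidePart bX'⊆) (sidePart bY⊆) (sidePart bY'⊆)
      (toBase r₁)
      (toBase (restrBase-contraction-irrelevant B⊆A rI₂ rI (inB bX⊆ bY'⊆) r₂))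
      (toBase (restrBase-contraction-irrelevant B⊆A rI₃ rI (inB bX'⊆ bY⊆) r₃)))
    where
    K = B₁ ─ A
    R = I ∪ K
    sidePart : ∀ {u T} → u ⊆ T ∩ B → u ∪ (R ∩ T) ⊆ T
    sidePart {u} {T} u⊆ = ∪-least (proj₁ ∘ x∈p∩q⁻ T B ∘ u⊆) (p∩q⊆q R T)
    inB : ∀ {u v} → u ⊆ S ∩ B → v ⊆ P ∩ B → u ∪ v ⊆ B
    inB u⊆ v⊆ = ∪-least (p∩q⊆q S B ∘ u⊆) (p∩q⊆q P B ∘ v⊆)
    rB₁ : RestrBase M A (B₁ ∩ A)
    rB₁ = subst (RestrBase M A) (sym B₁∩A≡) r₁
    regroup : ∀ u v → ((u ∪ v) ∪ I) ∪ K ≡ (u ∪ (R ∩ S)) ∪ (v ∪ (R ∩ P))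
    regroup u v = trans (∪-assoc (u ∪ v) I K) (∪-interchange-split S∪P≡⊤ u v R)
    toBase : ∀ {u v} → RestrBase M A ((u ∪ v) ∪ I) → IsBase M ((u ∪ (R ∩ S)) ∪ (v ∪ (R ∩ P)))
    toBase {u} {v} r = subst (IsBase M) (regroup u v) (restrBase∪outside-isBase b₁ rB₁ r)
    fromBase : IsBase M ((bX' ∪ (R ∩ S)) ∪ (bY' ∪ (R ∩ P))) → RestrBase M A ((bX' ∪ bY') ∪ I)
    fromBase b = base∪outside⇒restrBase b₁ rB₁ (∪-least (B⊆A ∘ inB bX'⊆ bY'⊆) (p─q⊆p A B ∘ proj₁ rI))
      (subst (IsBase M) (sym (regroup bX' bY')) b)

corollary29 : (N n k : ℕ) (M : Matroid N) (S P : Fin n → Subset N) →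
    (∀ j → S j ∩ P j ≡ ⊥) → (∀ j → S j ∪ P j ≡ ⊤) →
    (∀ j → Complete (IsBase M) (S j) (P j)) →
    (T : Fin k → Subset N) →
    (∀ x → ∃ λ m → x ∈ T m) → (∀ m l → m ≢ l → T m ∩ T l ≡ ⊥) →
    (∀ m l → m ≢ l → ∃ λ j → T m ⊆ S j × T l ⊆ P j) →
    ((A B : Subset N) → B ⊆ A → ∀ j →
        Complete (MinorBase M A B) (S j ∩ B) (P j ∩ B))
    ×
    ((Q : Fin k → Subset N) → (∀ j → Q j ⊆ T j) → ∀ i j → i ≢ j →
        (A B : Subset N) → B ⊆ A → B ≡ Q i ∪ Q j →
        Complete (MinorBase M A B) (Q i) (Q j))
corollary29 N n k M S P S∩P≡⊥ S∪P≡⊤ complete T _ _ separated = minors-complete , block-minors-complete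
  where
  minors-complete : (A B : Subset N) → B ⊆ A → ∀ j → Complete (MinorBase M A B) (S j ∩ B) (P j ∩ B)
  minors-complete A B B⊆A j = minor-complete M (S∪P≡⊤ j) (complete j) B⊆A
  block-minors-complete : (Q : Fin k → Subset N) → (∀ j → Q j ⊆ T j) → ∀ i j → i ≢ j →
    (A B : Subset N) → B ⊆ A → B ≡ Q i ∪ Q j → Complete (MinorBase M A B) (Q i) (Q j)
  block-minors-complete Q Q⊆T i j i≢j A _ B⊆A refl with separated i j i≢j
  ... | l , Tᵢ⊆Sₗ , Tⱼ⊆Pₗ = subst₂ (Complete (MinorBase M A (Q i ∪ Q j))) S∩Q≡Qᵢ P∩Q≡Qⱼ (minors-complete A _ B⊆A l)
    where
    S∩Q≡Qᵢ : S l ∩ (Q i ∪ Q j) ≡ Q i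
    S∩Q≡Qᵢ = p∩[a∪b]≡a (S∩P≡⊥ l) (Tᵢ⊆Sₗ ∘ Q⊆T i) (Tⱼ⊆Pₗ ∘ Q⊆T j)
    P∩Q≡Qⱼ : P l ∩ (Q i ∪ Q j) ≡ Q j
    P∩Q≡Qⱼ = trans (cong (P l ∩_) (∪-comm (Q i) (Q j)))
      (p∩[a∪b]≡a (trans (∩-comm (P l) (S l)) (S∩P≡⊥ l)) (Tⱼ⊆Pₗ ∘ Q⊆T j) (Tᵢ⊆Sₗ ∘ Q⊆T i))
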